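{- Let $1\leq t\leq k-2$ and $\binom{t+2}{2}(k-t+1)^2+t\leq n$. Then (i) if $1\leq t\leq k-3$, then $h_1(t,k,2k-t-2)>h_1(t,k,n)\geq h_1(t,k,2k-t-1)$, and equality in the second inequality holds only if $t=1$; (ii) if $t=k-2$, then $h_1(t,k,n)\geq h_1(t,k,k+1)$, and equality holds only if $t=1$.
   Context: For $X\subseteq M\subseteq C\subseteq[n]$ with $|X|=t$, $|M|=k$, $|C|=c\in\{k+1,\ldots,2k-t,n\}$: $\mathcal{H}_1(X,M,C)=\mathcal{A}\cup\mathcal{B}\cup\mathcal{C}$ where $\mathcal{A}=\{F\in\binom{[n]}{k}: X\subseteq F,\ |F\cap M|\geq t+1\}$, $\mathcal{B}=\{F\in\binom{[n]}{k}: F\cap M=X,\ |F\cap C|=c-k+t\}$, $\mathcal{C}=\{F\in\binom{C}{k}: |F\cap X|=t-1,\ |F\cap M|=k-1\}$; $h_1(t,k,c)=|\mathcal{H}_1(X,M,C)|$ (depends only on $n,t,k,c$). -}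

module Defs where

open import Data.Nat using (ℕ; zero; suc; _+_; _<ᵇ_; _≡ᵇ_; _≤ᵇ_)
open import Data.Bool using (Bool; true; false; _∧_; _∨_; not; if_then_else_)
open import Data.Fin using (Fin; toℕ)
open import Data.Vec using (Vec; []; _∷_; tabulate)
open import Data.List using (List; []; _∷_; map; _++_; filter; length)
open import Data.Fin.Subset using (Subset; _∩_; ∣_∣; inside; outside)

initSeg : (n m : ℕ) → Subset n
initSeg n m = tabulate (λ i → toℕ i <ᵇ m)

allSubsets : (n : ℕ) → List (Subset n)
allSubsets zero = [] ∷ []
allSubsets (suc n) = map (outside ∷_) (allSubsets n) ++ map (inside ∷_) (allSubsets n)

_⊆ᵇ_ : {n : ℕ} → Subset n → Subset n → Bool
[] ⊆ᵇ [] = true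
(a ∷ as) ⊆ᵇ (b ∷ bs) = (not a ∨ b) ∧ (as ⊆ᵇ bs)

_==ᵇ_ : {n : ℕ} → Subset n → Subset n → Bool
[] ==ᵇ [] = true
(a ∷ as) ==ᵇ (b ∷ bs) = (if a then b else not b) ∧ (as ==ᵇ bs)

-- Membership in H_1(X,M,C) with X=[t], M=[k], C=[c] (initial segments of [n]),
-- for F a k-subset of [n].
inA inB inC inH1 : (n t k c : ℕ) → Subset n → Bool
inA n t k c F = (initSeg n t ⊆ᵇ F) ∧ ((t + 1) ≤ᵇ ∣ F ∩ initSeg n k ∣)
inB n t k c F = ((F ∩ initSeg n k) ==ᵇ initSeg n t)
              ∧ (∣ F ∩ initSeg n c ∣ ≡ᵇ ((c Data.Nat.∸ k) + t))
inC n t k c F = (F ⊆ᵇ initSeg n c)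
              ∧ (∣ F ∩ initSeg n t ∣ ≡ᵇ (t Data.Nat.∸ 1))
              ∧ (∣ F ∩ initSeg n k ∣ ≡ᵇ (k Data.Nat.∸ 1))
inH1 n t k c F = (∣ F ∣ ≡ᵇ k) ∧ (inA n t k c F ∨ inB n t k c F ∨ inC n t k c F)

h1 : (n t k c : ℕ) → ℕ
h1 n t k c = length (filter (λ F → Data.Bool._≟_ (inH1 n t k c F) true) (allSubsets n))

-- Membership of a
-- set F in ℋ₁ = 𝒜 ∪ ℬ ∪ 𝒞 only depends on its profile, the numbers a, b, d, e of points it
-- takes from the four blocks X, M∖X, C∖M, [n]∖C.  So h₁ is a sum over profiles weighted by
-- products of binomial coefficients (Σsub-profile), and for t ≥ 1 the three families are
-- disjoint (member-split), giving h₁ = |𝒜| + |ℬ| + |𝒞| (h1-split).  We then evaluate: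
--   |𝒜| does not depend on c (sizeA-merge);  |𝒞| = t(c-k) (sizeC-value);
--   |ℬ| = C(n-c, r) if c = k + x with t + x + r = k (sizeB-value), and |ℬ| = 0 if c-k > k-t.
-- Writing k = t + r + x, the candidate c = 2k-t-r equals k + x, and with m = n - c:
--   h₁(c) = |𝒜| + C(m,r) + t·x   and   h₁(n) = |𝒜| + t·(x+m)   (h1-below, h1-top).
-- For r = 1 the difference h₁(n) - h₁(c) is (t-1)m (gap-one); for r = 2 it is
-- t·m - C(m,2) < 0 once m > 2t+1 (gap-two).  The hypothesis on n yields n ≥ 2k + t, which
-- is all these comparisons need (n-large), and for t = k-2 one has k+1 = 2k-t-1.

module Submission where

open import Defs
open import Data.Nat using (ℕ; zero; suc; _+_; _*_; _∸_; _^_; _≤_; _<_; _≥_; _>_; z≤n; s≤s; _≡ᵇ_; _≤ᵇ_)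
open import Data.Nat.Properties
open import Data.Nat.Combinatorics using (_C_; nCk+nC[k+1]≡[n+1]C[k+1]; nC1≡n)
open import Data.Bool using (Bool; true; false; _∧_; _∨_; T)
open import Data.Bool.Properties using (T-∧)
open import Data.Vec using ([]; _∷_)
open import Data.List using (List; []; _∷_; map; _++_; filter; length)
open import Data.Nat.ListAction using (sum)
open import Data.Nat.ListAction.Properties using (sum-++)
open import Data.List.Properties using (map-++; map-∘; map-cong)
open import Data.Fin.Subset using (Subset; _∩_; ∣_∣; inside; outside)
open import Data.Product using (_×_; _,_; ∃-syntax)
open import Data.Product.Function.NonDependent.Propositional using (_×-⇔_)
open import Data.Empty using (⊥; ⊥-elim)
open import Function using (_∘_)
open import Function.Bundles using (_⇔_; mk⇔; Equivalence)
import Function.Properties.Equivalence as ⇔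
open import Relation.Binary.PropositionalEquality
open import Data.Nat.Tactic.RingSolver using (solve-∀)

ind : Bool → ℕ
ind true  = 1
ind false = 0

Σsub : (n : ℕ) → (Subset n → ℕ) → ℕ
Σsub n f = sum (map f (allSubsets n))

h1-as-sum : ∀ n t k c → h1 n t k c ≡ Σsub n (ind ∘ inH1 n t k c)
h1-as-sum n t k c = count (allSubsets n)
  where
  count : (Fs : List (Subset n)) →
    length (filter (λ F → Data.Bool._≟_ (inH1 n t k c F) true) Fs) ≡ sum (map (ind ∘ inH1 n t k c) Fs)
  count [] = refl
  count (F ∷ Fs) with inH1 n t k c F
  ... | true  = cong suc (count Fs)
  ... | false = count Fs

Σsub-suc : ∀ n f → Σsub (suc n) f ≡ Σsub n (f ∘ (outside ∷_)) + Σsub n (f ∘ (inside ∷_))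
Σsub-suc n f = begin
  sum (map f (map (outside ∷_) Fs ++ map (inside ∷_) Fs))
    ≡⟨ cong sum (map-++ f (map (outside ∷_) Fs) _) ⟩
  sum (map f (map (outside ∷_) Fs) ++ map f (map (inside ∷_) Fs))
    ≡⟨ sum-++ (map f (map (outside ∷_) Fs)) _ ⟩
  sum (map f (map (outside ∷_) Fs)) + sum (map f (map (inside ∷_) Fs))
    ≡⟨ sym (cong₂ _+_ (cong sum (map-∘ Fs)) (cong sum (map-∘ Fs))) ⟩
  Σsub n (f ∘ (outside ∷_)) + Σsub n (f ∘ (inside ∷_)) ∎
  where
  open ≡-Reasoning
  Fs : List (Subset n)
  Fs = allSubsets n

Σsub-cong : ∀ n {f g : Subset n → ℕ} → (∀ F → f F ≡ g F) → Σsub n f ≡ Σsub n g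
Σsub-cong n f≗g = cong sum (map-cong f≗g (allSubsets n))

-- Σbin p g = Σₓ C(p,x)·g(x): summing g(|S|) over the subsets S of a p-element block.
-- It is defined by Pascal's recurrence (a new element is either avoided or used).
Σbin : ℕ → (ℕ → ℕ) → ℕ
Σbin zero    g = g 0
Σbin (suc p) g = Σbin p g + Σbin p (g ∘ suc)

Σbin-cong : ∀ p {f g : ℕ → ℕ} → (∀ x → f x ≡ g x) → Σbin p f ≡ Σbin p g
Σbin-cong zero    f≗g = f≗g 0
Σbin-cong (suc p) f≗g = cong₂ _+_ (Σbin-cong p f≗g) (Σbin-cong p (f≗g ∘ suc))

Σbin-+ : ∀ p (f g : ℕ → ℕ) → Σbin p (λ x → f x + g x) ≡ Σbin p f + Σbin p g
Σbin-+ zero    f g = refl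
Σbin-+ (suc p) f g = trans (cong₂ _+_ (Σbin-+ p f g) (Σbin-+ p (f ∘ suc) (g ∘ suc)))
                           (+-exch (Σbin p f) (Σbin p g) _ _)
  where
  +-exch : ∀ a b c d → (a + b) + (c + d) ≡ (a + c) + (b + d)
  +-exch = solve-∀

Σbin-*ˡ : ∀ p X (f : ℕ → ℕ) → Σbin p (λ x → X * f x) ≡ X * Σbin p f
Σbin-*ˡ zero    X f = refl
Σbin-*ˡ (suc p) X f = trans (cong₂ _+_ (Σbin-*ˡ p X f) (Σbin-*ˡ p X (f ∘ suc))) (sym (*-distribˡ-+ X _ _))

Σbin-*ʳ : ∀ p Y (f : ℕ → ℕ) → Σbin p (λ x → f x * Y) ≡ Σbin p f * Y
Σbin-*ʳ p Y f = trans (Σbin-cong p (λ x → *-comm (f x) Y)) (trans (Σbin-*ˡ p Y f) (*-comm Y _))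

Σbin-0 : ∀ p → Σbin p (λ _ → 0) ≡ 0
Σbin-0 p = Σbin-*ˡ p 0 (λ _ → 0)

-- Vandermonde: a (p+q)-block is a p-block followed by a q-block.
Σbin-merge : ∀ p q (f : ℕ → ℕ) → Σbin p (λ d → Σbin q (λ e → f (d + e))) ≡ Σbin (p + q) f
Σbin-merge zero    q f = refl
Σbin-merge (suc p) q f = cong₂ _+_ (Σbin-merge p q f) (Σbin-merge p q (f ∘ suc))

-- The binomial coefficient C(p,r), as the number of r-subsets of a p-block.
choose : ℕ → ℕ → ℕ
choose p r = Σbin p (λ x → ind (x ≡ᵇ r))

choose-0 : ∀ p → choose p 0 ≡ 1
choose-0 zero    = refl
choose-0 (suc p) = cong₂ _+_ (choose-0 p) (Σbin-0 p)

choose-> : ∀ p r → p < r → choose p r ≡ 0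
choose-> zero    (suc r) _         = refl
choose-> (suc p) (suc r) (s≤s p<r) = cong₂ _+_ (choose-> p (suc r) (m≤n⇒m≤1+n p<r)) (choose-> p r p<r)

choose-all : ∀ p → choose p p ≡ 1
choose-all zero    = refl
choose-all (suc p) = cong₂ _+_ (choose-> p (suc p) ≤-refl) (choose-all p)

choose-1 : ∀ p → choose p 1 ≡ p
choose-1 zero    = refl
choose-1 (suc p) = trans (cong₂ _+_ (choose-1 p) (choose-0 p)) (+-comm p 1)

choose-all-but-one : ∀ p → choose (suc p) p ≡ suc p
choose-all-but-one zero    = refl
choose-all-but-one (suc p) = cong₂ _+_ (choose-all (suc p)) (choose-all-but-one p)

choose-2 : ∀ p → 2 * choose p 2 + p ≡ p * p
choose-2 zero    = refl
choose-2 (suc p) = begin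
  2 * (choose p 2 + choose p 1) + suc p ≡⟨ cong (λ z → 2 * (choose p 2 + z) + suc p) (choose-1 p) ⟩
  2 * (choose p 2 + p) + suc p          ≡⟨ regroup (choose p 2) p ⟩
  (2 * choose p 2 + p) + (2 * p + 1)    ≡⟨ cong (_+ (2 * p + 1)) (choose-2 p) ⟩
  p * p + (2 * p + 1)                   ≡⟨ square p ⟩
  suc p * suc p                         ∎
  where
  open ≡-Reasoning
  regroup : ∀ c p → 2 * (c + p) + suc p ≡ (2 * c + p) + (2 * p + 1)
  regroup = solve-∀
  square : ∀ p → p * p + (2 * p + 1) ≡ suc p * suc p
  square = solve-∀

count : ∀ {n} → ℕ → Subset n → ℕ
count {n} m F = ∣ F ∩ initSeg n m ∣

-- Sum of G(a,b,d,e) over the numbers of points chosen in the four consecutive blocks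
-- [t], [k]∖[t], [c]∖[k], [n]∖[c], each weighted by the number of such choices.
Σprofile : (n t k c : ℕ) → (ℕ → ℕ → ℕ → ℕ → ℕ) → ℕ
Σprofile n t k c G =
  Σbin t λ a → Σbin (k ∸ t) λ b → Σbin (c ∸ k) λ d → Σbin (n ∸ c) λ e → G a b d e

-- Induction on n, splitting off the first point, which lies
-- in the first nonempty block.
Σsub-profile : ∀ n t k c → t ≤ k → k ≤ c → c ≤ n → (R : ℕ → ℕ → ℕ → ℕ → ℕ) →
  Σsub n (λ F → R (count t F) (count k F) (count c F) ∣ F ∣)
  ≡ Σprofile n t k c (λ a b d e → R a (a + b) (a + b + d) (a + b + d + e))
Σsub-profile zero .0 .0 .0 z≤n z≤n z≤n R = +-identityʳ _
Σsub-profile (suc n) (suc t) (suc k) (suc c) (s≤s t≤k) (s≤s k≤c) (s≤s c≤n) R =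
  trans (Σsub-suc n _) (cong₂ _+_ (Σsub-profile n t k c t≤k k≤c c≤n R)
    (Σsub-profile n t k c t≤k k≤c c≤n (λ a K L s → R (suc a) (suc K) (suc L) (suc s))))
Σsub-profile (suc n) zero (suc k) (suc c) z≤n (s≤s k≤c) (s≤s c≤n) R =
  trans (Σsub-suc n _) (cong₂ _+_ (Σsub-profile n 0 k c z≤n k≤c c≤n R)
    (Σsub-profile n 0 k c z≤n k≤c c≤n (λ a K L s → R a (suc K) (suc L) (suc s))))
Σsub-profile (suc n) zero zero (suc c) z≤n z≤n (s≤s c≤n) R =
  trans (Σsub-suc n _) (cong₂ _+_ (Σsub-profile n 0 0 c z≤n z≤n c≤n R)
    (Σsub-profile n 0 0 c z≤n z≤n c≤n (λ a K L s → R a K (suc L) (suc s))))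
Σsub-profile (suc n) zero zero zero z≤n z≤n z≤n R =
  trans (Σsub-suc n _) (cong₂ _+_ (Σsub-profile n 0 0 0 z≤n z≤n z≤n R)
    (Σsub-profile n 0 0 0 z≤n z≤n z≤n (λ a K L s → R a K L (suc s))))

Σprofile-cong : ∀ n t k c {G H : ℕ → ℕ → ℕ → ℕ → ℕ} → (∀ a b d e → G a b d e ≡ H a b d e) →
  Σprofile n t k c G ≡ Σprofile n t k c H
Σprofile-cong n t k c G≗H =
  Σbin-cong t λ a → Σbin-cong (k ∸ t) λ b → Σbin-cong (c ∸ k) λ d → Σbin-cong (n ∸ c) λ e → G≗H a b d e

Σprofile-+ : ∀ n t k c (G H : ℕ → ℕ → ℕ → ℕ → ℕ) →
  Σprofile n t k c (λ a b d e → G a b d e + H a b d e) ≡ Σprofile n t k c G + Σprofile n t k c H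
Σprofile-+ n t k c G H =
  trans (Σbin-cong t λ a → trans (Σbin-cong (k ∸ t) λ b → trans (Σbin-cong (c ∸ k) λ d →
    Σbin-+ (n ∸ c) _ _) (Σbin-+ (c ∸ k) _ _)) (Σbin-+ (k ∸ t) _ _)) (Σbin-+ t _ _)

Σprofile-0 : ∀ n t k c → Σprofile n t k c (λ _ _ _ _ → 0) ≡ 0
Σprofile-0 n t k c = trans (Σbin-cong t λ a → trans (Σbin-cong (k ∸ t) λ b →
  trans (Σbin-cong (c ∸ k) λ d → Σbin-0 (n ∸ c)) (Σbin-0 (c ∸ k))) (Σbin-0 (k ∸ t))) (Σbin-0 t)

Σprofile-product : ∀ n t k c (f g h j : ℕ → ℕ) →
  Σprofile n t k c (λ a b d e → f a * (g b * (h d * j e)))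
  ≡ Σbin t f * (Σbin (k ∸ t) g * (Σbin (c ∸ k) h * Σbin (n ∸ c) j))
Σprofile-product n t k c f g h j = trans (Σbin-cong t λ a → trans (Σbin-cong (k ∸ t) λ b →
    trans (Σbin-cong (c ∸ k) λ d → pull₃ (n ∸ c) (f a) (g b) (h d) j)
    (pull₂ (c ∸ k) (f a) (g b) h))
    (trans (Σbin-*ˡ (k ∸ t) (f a) _) (cong (f a *_) (Σbin-*ʳ (k ∸ t) _ g))))
  (Σbin-*ʳ t _ f)
  where
  pull₃ : ∀ p X Y Z u → Σbin p (λ x → X * (Y * (Z * u x))) ≡ X * (Y * (Z * Σbin p u))
  pull₃ p X Y Z u = trans (Σbin-*ˡ p X _) (cong (X *_) (trans (Σbin-*ˡ p Y _) (cong (Y *_) (Σbin-*ˡ p Z u))))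
  pull₂ : ∀ p X Y u {W} → Σbin p (λ x → X * (Y * (u x * W))) ≡ X * (Y * (Σbin p u * W))
  pull₂ p X Y u = trans (Σbin-*ˡ p X _) (cong (X *_) (trans (Σbin-*ˡ p Y _) (cong (Y *_) (Σbin-*ʳ p _ u))))

count-0 : ∀ {n} (F : Subset n) → count 0 F ≡ 0
count-0 []          = refl
count-0 (true ∷ F)  = count-0 F
count-0 (false ∷ F) = count-0 F

count-≤ : ∀ {n} m (F : Subset n) → count m F ≤ m
count-≤ zero    F           = ≤-reflexive (count-0 F)
count-≤ (suc m) []          = z≤n
count-≤ (suc m) (true ∷ F)  = s≤s (count-≤ m F)
count-≤ (suc m) (false ∷ F) = m≤n⇒m≤1+n (count-≤ m F)

≡ᵇ-1+ : ∀ a m → a ≤ m → (a ≡ᵇ suc m) ≡ false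
≡ᵇ-1+ zero    m       a≤m       = refl
≡ᵇ-1+ (suc a) (suc m) (s≤s a≤m) = ≡ᵇ-1+ a m a≤m

initSeg-⊆ : ∀ {n} m (F : Subset n) → m ≤ n → (initSeg n m ⊆ᵇ F) ≡ (count m F ≡ᵇ m)
initSeg-⊆ zero    F           _         = trans (empty-⊆ F) (cong (_≡ᵇ 0) (sym (count-0 F)))
  where
  empty-⊆ : ∀ {n} (F : Subset n) → (initSeg n 0 ⊆ᵇ F) ≡ true
  empty-⊆ []      = refl
  empty-⊆ (x ∷ F) = empty-⊆ F
initSeg-⊆ (suc m) (true ∷ F)  (s≤s m≤n) = initSeg-⊆ m F m≤n
initSeg-⊆ (suc m) (false ∷ F) (s≤s m≤n) = sym (≡ᵇ-1+ _ m (count-≤ m F))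

∩-initSeg-≡ : ∀ {n} t k (F : Subset n) → t ≤ k → k ≤ n →
  ((F ∩ initSeg n k) ==ᵇ initSeg n t) ≡ ((count t F ≡ᵇ t) ∧ (count k F ≡ᵇ t))
∩-initSeg-≡ zero    zero    []          _         _         = refl
∩-initSeg-≡ zero    zero    (true ∷ F)  _         _         = ∩-initSeg-≡ 0 0 F z≤n z≤n
∩-initSeg-≡ zero    zero    (false ∷ F) _         _         = ∩-initSeg-≡ 0 0 F z≤n z≤n
∩-initSeg-≡ zero    (suc k) (true ∷ F)  _         _         rewrite count-0 F = refl
∩-initSeg-≡ zero    (suc k) (false ∷ F) _         (s≤s k≤n) = ∩-initSeg-≡ 0 k F z≤n k≤n
∩-initSeg-≡ (suc t) (suc k) (true ∷ F)  (s≤s t≤k) (s≤s k≤n) = ∩-initSeg-≡ t k F t≤k k≤n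
∩-initSeg-≡ (suc t) (suc k) (false ∷ F) (s≤s t≤k) (s≤s k≤n)
  rewrite ≡ᵇ-1+ _ t (count-≤ t F) = refl

⊆-initSeg : ∀ {n} c (F : Subset n) → (F ⊆ᵇ initSeg n c) ≡ (count c F ≡ᵇ ∣ F ∣)
⊆-initSeg c       []          = refl
⊆-initSeg zero    (true ∷ F)  rewrite count-0 F = refl
⊆-initSeg zero    (false ∷ F) = ⊆-initSeg 0 F
⊆-initSeg (suc c) (true ∷ F)  = ⊆-initSeg c F
⊆-initSeg (suc c) (false ∷ F) = ⊆-initSeg c F

-- The conditions defining 𝒜, ℬ, 𝒞, in terms of a = |F∩X|, K = |F∩M|, L = |F∩C|, s = |F|.
condA : (t a K : ℕ) → Bool
condA t a K = (a ≡ᵇ t) ∧ (t + 1 ≤ᵇ K)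

condB : (t k c a K L : ℕ) → Bool
condB t k c a K L = ((a ≡ᵇ t) ∧ (K ≡ᵇ t)) ∧ (L ≡ᵇ (c ∸ k) + t)

condC : (t k a K L s : ℕ) → Bool
condC t k a K L s = (L ≡ᵇ s) ∧ (a ≡ᵇ t ∸ 1) ∧ (K ≡ᵇ k ∸ 1)

memberᶜ : (t k c a K L s : ℕ) → Bool
memberᶜ t k c a K L s = (s ≡ᵇ k) ∧ (condA t a K ∨ condB t k c a K L ∨ condC t k a K L s)

inH1-counts : ∀ n t k c (F : Subset n) → t ≤ k → k ≤ n →
  inH1 n t k c F ≡ memberᶜ t k c (count t F) (count k F) (count c F) ∣ F ∣
inH1-counts n t k c F t≤k k≤n
  rewrite initSeg-⊆ t F (≤-trans t≤k k≤n) | ∩-initSeg-≡ t k F t≤k k≤n | ⊆-initSeg c F = refl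

isA : (t k a b d e : ℕ) → Bool
isA t k a b d e = (a + b + d + e ≡ᵇ k) ∧ condA t a (a + b)

isB : (t k c a b d e : ℕ) → Bool
isB t k c a b d e = (a + b + d + e ≡ᵇ k) ∧ condB t k c a (a + b) (a + b + d)

isC : (t k a b d e : ℕ) → Bool
isC t k a b d e = (a + b + d + e ≡ᵇ k) ∧ condC t k a (a + b) (a + b + d) (a + b + d + e)

-- |𝒜| only sees the blocks X and M∖X, and the rest [n]∖M as a whole.
sizeA : (n t k : ℕ) → ℕ
sizeA n t k = Σbin t λ a → Σbin (k ∸ t) λ b → Σbin (n ∸ k) λ m → ind ((a + b + m ≡ᵇ k) ∧ condA t a (a + b))

sizeB sizeC : (n t k c : ℕ) → ℕ
sizeB n t k c = Σprofile n t k c (λ a b d e → ind (isB t k c a b d e))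
sizeC n t k c = Σprofile n t k c (λ a b d e → ind (isC t k a b d e))

T-≡ᵇ : ∀ {m n} → T (m ≡ᵇ n) ⇔ (m ≡ n)
T-≡ᵇ {m} {n} = mk⇔ (≡ᵇ⇒≡ m n) (≡⇒≡ᵇ m n)

T-≤ᵇ : ∀ {m n} → T (m ≤ᵇ n) ⇔ (m ≤ n)
T-≤ᵇ {m} {n} = mk⇔ (≤ᵇ⇒≤ m n) ≤⇒≤ᵇ

T-∧⇔ : ∀ {x y} {A B : Set} → T x ⇔ A → T y ⇔ B → T (x ∧ y) ⇔ (A × B)
T-∧⇔ x⇔A y⇔B = ⇔.trans T-∧ (x⇔A ×-⇔ y⇔B)

condA-spec : ∀ {t a K} → T (condA t a K) ⇔ (a ≡ t × t + 1 ≤ K)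
condA-spec = T-∧⇔ T-≡ᵇ T-≤ᵇ

condB-spec : ∀ {t k c a K L} → T (condB t k c a K L) ⇔ ((a ≡ t × K ≡ t) × L ≡ (c ∸ k) + t)
condB-spec = T-∧⇔ (T-∧⇔ T-≡ᵇ T-≡ᵇ) T-≡ᵇ

condC-spec : ∀ {t k a K L s} → T (condC t k a K L s) ⇔ (L ≡ s × a ≡ t ∸ 1 × K ≡ k ∸ 1)
condC-spec = T-∧⇔ T-≡ᵇ (T-∧⇔ T-≡ᵇ T-≡ᵇ)

ind-disjoint : ∀ z x y w → (T x → T y → ⊥) → (T x → T w → ⊥) → (T y → T w → ⊥) →
  ind (z ∧ (x ∨ y ∨ w)) ≡ ind (z ∧ x) + ind (z ∧ y) + ind (z ∧ w)
ind-disjoint false x     y     w     _   _   _   = refl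
ind-disjoint true  true  true  w     x#y _   _   = ⊥-elim (x#y _ _)
ind-disjoint true  true  false true  _   x#w _   = ⊥-elim (x#w _ _)
ind-disjoint true  true  false false _   _   _   = refl
ind-disjoint true  false true  true  _   _   y#w = ⊥-elim (y#w _ _)
ind-disjoint true  false true  false _   _   _   = refl
ind-disjoint true  false false true  _   _   _   = refl
ind-disjoint true  false false false _   _   _   = refl

ind-iff : ∀ {x y} → T x ⇔ T y → ind x ≡ ind y
ind-iff {false} {false} _   = refl
ind-iff {false} {true}  x⇔y = ⊥-elim (Equivalence.from x⇔y _)
ind-iff {true}  {false} x⇔y = ⊥-elim (Equivalence.to x⇔y _)
ind-iff {true}  {true}  _   = refl

ind-∧ : ∀ x y → ind (x ∧ y) ≡ ind x * ind y
ind-∧ false y = refl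
ind-∧ true  y = sym (+-identityʳ (ind y))

≢-pred : ∀ {t} → 1 ≤ t → t ≡ t ∸ 1 → ⊥
≢-pred {suc t} _ = 1+m≢m∸n 0

-- For t ≥ 1 the families 𝒜, ℬ, 𝒞 are pairwise disjoint: 𝒜 and ℬ contain X while members
-- of 𝒞 meet X in t-1 points, and members of 𝒜 meet M in more than t points, those of ℬ in t.
member-split : ∀ t k c a b d e → 1 ≤ t →
  ind (memberᶜ t k c a (a + b) (a + b + d) (a + b + d + e))
  ≡ ind (isA t k a b d e) + ind (isB t k c a b d e) + ind (isC t k a b d e)
member-split t k c a b d e 1≤t = ind-disjoint _ _ _ _ A#B A#C B#C
  where
  A? B? C? : Bool
  A? = condA t a (a + b)
  B? = condB t k c a (a + b) (a + b + d)
  C? = condC t k a (a + b) (a + b + d) (a + b + d + e)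
  specA : T A? → a ≡ t × t + 1 ≤ a + b
  specA = Equivalence.to condA-spec
  specB : T B? → (a ≡ t × a + b ≡ t) × a + b + d ≡ (c ∸ k) + t
  specB = Equivalence.to (condB-spec {k = k} {c = c})
  specC : T C? → a + b + d ≡ a + b + d + e × a ≡ t ∸ 1 × a + b ≡ k ∸ 1
  specC = Equivalence.to (condC-spec {t = t} {k = k})
  t≢t-1 : a ≡ t → a ≡ t ∸ 1 → ⊥
  t≢t-1 refl = ≢-pred 1≤t
  A#B : T A? → T B? → ⊥
  A#B hA hB with specA hA | specB hB
  ... | _ , t<K | (_ , K≡t) , _ = <-irrefl (sym K≡t) (subst (_≤ a + b) (+-comm t 1) t<K)
  A#C : T A? → T C? → ⊥
  A#C hA hC with specA hA | specC hC
  ... | a≡t , _ | _ , a≡t-1 , _ = t≢t-1 a≡t a≡t-1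
  B#C : T B? → T C? → ⊥
  B#C hB hC with specB hB | specC hC
  ... | (a≡t , _) , _ | _ , a≡t-1 , _ = t≢t-1 a≡t a≡t-1

-- Membership in 𝒜 does not distinguish C∖M from [n]∖C, so those two blocks merge.
sizeA-merge : ∀ n t k c → k ≤ c → c ≤ n → Σprofile n t k c (λ a b d e → ind (isA t k a b d e)) ≡ sizeA n t k
sizeA-merge n t k c k≤c c≤n = Σbin-cong t λ a → Σbin-cong (k ∸ t) λ b → merge-row a b
  where
  open ≡-Reasoning
  blocks : (c ∸ k) + (n ∸ c) ≡ n ∸ k
  blocks = trans (sym (+-∸-comm (n ∸ c) k≤c)) (cong (_∸ k) (m+[n∸m]≡n c≤n))
  merge-row : ∀ a b → Σbin (c ∸ k) (λ d → Σbin (n ∸ c) λ e → ind (isA t k a b d e))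
                    ≡ Σbin (n ∸ k) (λ m → ind ((a + b + m ≡ᵇ k) ∧ condA t a (a + b)))
  merge-row a b = begin
    Σbin (c ∸ k) (λ d → Σbin (n ∸ c) λ e → ind (isA t k a b d e))
      ≡⟨ Σbin-cong (c ∸ k) (λ d → Σbin-cong (n ∸ c) λ e →
           cong (λ s → ind ((s ≡ᵇ k) ∧ condA t a (a + b))) (+-assoc (a + b) d e)) ⟩
    Σbin (c ∸ k) (λ d → Σbin (n ∸ c) λ e → g (d + e))
      ≡⟨ Σbin-merge (c ∸ k) (n ∸ c) g ⟩
    Σbin ((c ∸ k) + (n ∸ c)) g
      ≡⟨ cong (λ p → Σbin p g) blocks ⟩
    Σbin (n ∸ k) g ∎
    where
    g : ℕ → ℕ
    g m = ind ((a + b + m ≡ᵇ k) ∧ condA t a (a + b))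

h1-split : ∀ n t k c → 1 ≤ t → t ≤ k → k ≤ c → c ≤ n →
  h1 n t k c ≡ sizeA n t k + sizeB n t k c + sizeC n t k c
h1-split n t k c 1≤t t≤k k≤c c≤n = begin
  h1 n t k c
    ≡⟨ h1-as-sum n t k c ⟩
  Σsub n (ind ∘ inH1 n t k c)
    ≡⟨ Σsub-cong n (λ F → cong ind (inH1-counts n t k c F t≤k (≤-trans k≤c c≤n))) ⟩
  Σsub n (λ F → ind (memberᶜ t k c (count t F) (count k F) (count c F) ∣ F ∣))
    ≡⟨ Σsub-profile n t k c t≤k k≤c c≤n (λ a K L s → ind (memberᶜ t k c a K L s)) ⟩
  Σprofile n t k c (λ a b d e → ind (memberᶜ t k c a (a + b) (a + b + d) (a + b + d + e)))
    ≡⟨ Σprofile-cong n t k c (λ a b d e → member-split t k c a b d e 1≤t) ⟩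
  Σprofile n t k c (λ a b d e → ind (isA t k a b d e) + ind (isB t k c a b d e) + ind (isC t k a b d e))
    ≡⟨ Σprofile-+ n t k c _ _ ⟩
  Σprofile n t k c (λ a b d e → ind (isA t k a b d e) + ind (isB t k c a b d e)) + sizeC n t k c
    ≡⟨ cong (_+ sizeC n t k c) (Σprofile-+ n t k c _ _) ⟩
  Σprofile n t k c (λ a b d e → ind (isA t k a b d e)) + sizeB n t k c + sizeC n t k c
    ≡⟨ cong (λ A → A + sizeB n t k c + sizeC n t k c) (sizeA-merge n t k c k≤c c≤n) ⟩
  sizeA n t k + sizeB n t k c + sizeC n t k c ∎
  where open ≡-Reasoning

Σprofile-point : ∀ n t k c (G : ℕ → ℕ → ℕ → ℕ → Bool) a₀ b₀ d₀ e₀ →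
  (∀ a b d e → T (G a b d e) ⇔ (a ≡ a₀ × b ≡ b₀ × d ≡ d₀ × e ≡ e₀)) →
  Σprofile n t k c (λ a b d e → ind (G a b d e))
  ≡ choose t a₀ * (choose (k ∸ t) b₀ * (choose (c ∸ k) d₀ * choose (n ∸ c) e₀))
Σprofile-point n t k c G a₀ b₀ d₀ e₀ G-spec =
  trans (Σprofile-cong n t k c point) (Σprofile-product n t k c _ _ _ _)
  where
  δ : ℕ → ℕ → Bool
  δ = _≡ᵇ_
  point : ∀ a b d e → ind (G a b d e) ≡ ind (δ a a₀) * (ind (δ b b₀) * (ind (δ d d₀) * ind (δ e e₀)))
  point a b d e = begin
    ind (G a b d e)
      ≡⟨ ind-iff (⇔.trans (G-spec a b d e) (⇔.sym (T-∧⇔ T-≡ᵇ (T-∧⇔ T-≡ᵇ (T-∧⇔ T-≡ᵇ T-≡ᵇ))))) ⟩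
    ind (δ a a₀ ∧ δ b b₀ ∧ δ d d₀ ∧ δ e e₀)
      ≡⟨ ind-∧ (δ a a₀) _ ⟩
    ind (δ a a₀) * ind (δ b b₀ ∧ δ d d₀ ∧ δ e e₀)
      ≡⟨ cong (ind (δ a a₀) *_) (trans (ind-∧ (δ b b₀) _) (cong (ind (δ b b₀) *_) (ind-∧ (δ d d₀) _))) ⟩
    ind (δ a a₀) * (ind (δ b b₀) * (ind (δ d d₀) * ind (δ e e₀))) ∎
    where open ≡-Reasoning

-- Members of ℬ: all of X, nothing else of M, all of C∖M, and the remaining r points outside C.
B-profile : ∀ {t x r a b d e} →
  (a + b + d + e ≡ t + x + r × (a ≡ t × a + b ≡ t) × a + b + d ≡ x + t)
  ⇔ (a ≡ t × b ≡ 0 × d ≡ x × e ≡ r)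
B-profile {t} {x} {r} = mk⇔ solve (λ { (refl , refl , refl , refl) → check })
  where
  solve : ∀ {a b d e} → a + b + d + e ≡ t + x + r × (a ≡ t × a + b ≡ t) × a + b + d ≡ x + t →
    a ≡ t × b ≡ 0 × d ≡ x × e ≡ r
  solve {a} {b} {d} {e} (size , (refl , a+b≡a) , a+b+d≡x+a)
    with +-cancelˡ-≡ a b 0 (trans a+b≡a (sym (+-identityʳ a)))
  ... | refl with +-cancelˡ-≡ (a + 0) d x (trans a+b+d≡x+a (trans (+-comm x a) (cong (_+ x) (sym (+-identityʳ a)))))
  ... | refl = refl , refl , refl , +-cancelˡ-≡ (a + x) e r (trans (cong (λ z → z + x + e) (sym (+-identityʳ a))) size)
  check : t + 0 + x + r ≡ t + x + r × (t ≡ t × t + 0 ≡ t) × t + 0 + x ≡ x + t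
  check = cong (λ z → z + x + r) (+-identityʳ t) , (refl , +-identityʳ t) , trans (cong (_+ x) (+-identityʳ t)) (+-comm t x)

-- Members of 𝒞 (for |X| = t+1, |M| = k+1): t points of X, all of M∖X, one point of C∖M, and
-- nothing outside C.
C-profile : ∀ {t k a b d e} → t ≤ k →
  (a + b + d + e ≡ suc k × a + b + d ≡ a + b + d + e × a ≡ t × a + b ≡ k)
  ⇔ (a ≡ t × b ≡ k ∸ t × d ≡ 1 × e ≡ 0)
C-profile {t} {k} t≤k = mk⇔ solve (λ { (refl , refl , refl , refl) → check })
  where
  solve : ∀ {a b d e} → a + b + d + e ≡ suc k × a + b + d ≡ a + b + d + e × a ≡ t × a + b ≡ k →
    a ≡ t × b ≡ k ∸ t × d ≡ 1 × e ≡ 0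
  solve {a} {b} {d} {e} (size , no-outside , refl , refl)
    with +-cancelˡ-≡ (a + b + d) 0 e (trans (+-identityʳ _) no-outside)
  ... | refl = refl , sym (m+n∸m≡n a b) ,
               +-cancelˡ-≡ (a + b) d 1 (trans (sym (+-identityʳ _)) (trans size (+-comm 1 (a + b)))) , refl
  check : t + (k ∸ t) + 1 + 0 ≡ suc k × t + (k ∸ t) + 1 ≡ t + (k ∸ t) + 1 + 0 × t ≡ t × t + (k ∸ t) ≡ k
  check = trans (+-identityʳ _) (trans (cong (_+ 1) (m+[n∸m]≡n t≤k)) (+-comm k 1)) ,
          sym (+-identityʳ _) , refl , m+[n∸m]≡n t≤k

isB-spec : ∀ {t k c a b d e} →
  T (isB t k c a b d e) ⇔ (a + b + d + e ≡ k × (a ≡ t × a + b ≡ t) × a + b + d ≡ (c ∸ k) + t)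
isB-spec {t} {k} {c} = T-∧⇔ T-≡ᵇ (condB-spec {k = k} {c = c})

isC-spec : ∀ {t k a b d e} →
  T (isC t k a b d e) ⇔ (a + b + d + e ≡ k × a + b + d ≡ a + b + d + e × a ≡ t ∸ 1 × a + b ≡ k ∸ 1)
isC-spec {t} {k} = T-∧⇔ T-≡ᵇ (condC-spec {t = t} {k = k})

-- |ℬ| = C(n-c, r) when c = k + x and t + x + r = k: the r extra points lie outside C.
sizeB-value : ∀ n t k c r → t + (c ∸ k) + r ≡ k → sizeB n t k c ≡ choose (n ∸ c) r
sizeB-value n t k c r t+x+r≡k = begin
  sizeB n t k c
    ≡⟨ Σprofile-point n t k c (isB t k c) t 0 (c ∸ k) r spec ⟩
  choose t t * (choose (k ∸ t) 0 * (choose (c ∸ k) (c ∸ k) * choose (n ∸ c) r))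
    ≡⟨ cong₂ _*_ (choose-all t) (cong₂ _*_ (choose-0 (k ∸ t)) (cong₂ _*_ (choose-all (c ∸ k)) refl)) ⟩
  1 * (1 * (1 * choose (n ∸ c) r))
    ≡⟨ trans (*-identityˡ _) (trans (*-identityˡ _) (*-identityˡ _)) ⟩
  choose (n ∸ c) r ∎
  where
  open ≡-Reasoning
  spec : ∀ a b d e → T (isB t k c a b d e) ⇔ (a ≡ t × b ≡ 0 × d ≡ c ∸ k × e ≡ r)
  spec a b d e = ⇔.trans (isB-spec {t} {k} {c} {a} {b} {d} {e})
    (subst (λ K → (a + b + d + e ≡ K × (a ≡ t × a + b ≡ t) × a + b + d ≡ (c ∸ k) + t)
                  ⇔ (a ≡ t × b ≡ 0 × d ≡ c ∸ k × e ≡ r)) t+x+r≡k B-profile)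

-- ℬ is empty when C∖M is too large to fit into a k-set besides X.
sizeB-empty : ∀ n t k c → k < t + (c ∸ k) → sizeB n t k c ≡ 0
sizeB-empty n t k c k<t+x =
  trans (Σprofile-cong n t k c (λ a b d e → ind-false (impossible a b d e))) (Σprofile-0 n t k c)
  where
  ind-false : ∀ {x} → (T x → ⊥) → ind x ≡ 0
  ind-false {false} _ = refl
  ind-false {true}  ¬x = ⊥-elim (¬x _)
  impossible : ∀ a b d e → T (isB t k c a b d e) → ⊥
  impossible a b d e h with Equivalence.to (isB-spec {t} {k} {c} {a} {b} {d} {e}) h
  ... | sum≡k , _ , a+b+d≡x+t = <-irrefl refl (begin-strict
    k                 <⟨ k<t+x ⟩
    t + (c ∸ k)       ≡⟨ +-comm t (c ∸ k) ⟩
    (c ∸ k) + t       ≡⟨ sym a+b+d≡x+t ⟩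
    a + b + d         ≤⟨ m≤m+n (a + b + d) e ⟩
    a + b + d + e     ≡⟨ sum≡k ⟩
    k                 ∎)
    where open ≤-Reasoning

-- |𝒞| = t(c-k): choose the missing point of X and the extra point of C∖M.
sizeC-value : ∀ n t k c → 1 ≤ t → t ≤ k → sizeC n t k c ≡ t * (c ∸ k)
sizeC-value n (suc t) (suc k) c _ (s≤s t≤k) = begin
  sizeC n (suc t) (suc k) c
    ≡⟨ Σprofile-point n (suc t) (suc k) c (isC (suc t) (suc k)) t (k ∸ t) 1 0
         (λ a b d e → ⇔.trans (isC-spec {suc t} {suc k} {a} {b} {d} {e}) (C-profile t≤k)) ⟩
  choose (suc t) t * (choose (k ∸ t) (k ∸ t) * (choose (c ∸ suc k) 1 * choose (n ∸ c) 0))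
    ≡⟨ cong₂ _*_ (choose-all-but-one t) (cong₂ _*_ (choose-all (k ∸ t)) (cong₂ _*_ (choose-1 (c ∸ suc k)) (choose-0 (n ∸ c)))) ⟩
  suc t * (1 * ((c ∸ suc k) * 1))
    ≡⟨ cong (suc t *_) (trans (*-identityˡ _) (*-identityʳ _)) ⟩
  suc t * (c ∸ suc k) ∎
  where open ≡-Reasoning

h1-below : ∀ {n c} t r x m → 1 ≤ t → c ≡ t + r + x + x → n ≡ c + m →
  h1 n t (t + r + x) c ≡ sizeA n t (t + r + x) + choose m r + t * x
h1-below {n} {c} t r x m 1≤t refl refl = begin
  h1 n t k c
    ≡⟨ h1-split n t k c 1≤t (≤-trans (m≤m+n t r) (m≤m+n (t + r) x)) (m≤m+n k x) (m≤m+n c m) ⟩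
  sizeA n t k + sizeB n t k c + sizeC n t k c
    ≡⟨ cong₂ (λ B L → sizeA n t k + B + L)
         (sizeB-value n t k c r (trans (cong (λ z → t + z + r) c-k≡x) (swap t x r)))
         (sizeC-value n t k c 1≤t (≤-trans (m≤m+n t r) (m≤m+n (t + r) x))) ⟩
  sizeA n t k + choose (n ∸ c) r + t * (c ∸ k)
    ≡⟨ cong₂ (λ m′ x′ → sizeA n t k + choose m′ r + t * x′) (m+n∸m≡n c m) c-k≡x ⟩
  sizeA n t k + choose m r + t * x ∎
  where
  open ≡-Reasoning
  k : ℕ
  k = t + r + x
  c-k≡x : c ∸ k ≡ x
  c-k≡x = m+n∸m≡n k x
  swap : ∀ t x r → t + x + r ≡ t + r + x
  swap = solve-∀

-- h₁ at c = n, when C∖M = [n]∖M is too large for ℬ: h₁ = |𝒜| + t(n-k).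
h1-top : ∀ {n} t k y → 1 ≤ t → t ≤ k → n ≡ k + y → k < t + y → h1 n t k n ≡ sizeA n t k + t * y
h1-top {n} t k y 1≤t t≤k refl k<t+y = begin
  h1 n t k n
    ≡⟨ h1-split n t k n 1≤t t≤k (m≤m+n k y) ≤-refl ⟩
  sizeA n t k + sizeB n t k n + sizeC n t k n
    ≡⟨ cong₂ (λ B L → sizeA n t k + B + L)
         (sizeB-empty n t k n (subst (λ z → k < t + z) (sym n-k≡y) k<t+y)) (sizeC-value n t k n 1≤t t≤k) ⟩
  sizeA n t k + 0 + t * (n ∸ k)
    ≡⟨ cong₂ _+_ (+-identityʳ (sizeA n t k)) (cong (t *_) n-k≡y) ⟩
  sizeA n t k + t * y ∎
  where
  open ≡-Reasoning
  n-k≡y : n ∸ k ≡ y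
  n-k≡y = m+n∸m≡n k y

twice-minus : ∀ t r x → 2 * (t + r + x) ∸ t ∸ r ≡ t + r + x + x
twice-minus t r x = begin
  2 * (t + r + x) ∸ t ∸ r             ≡⟨ ∸-+-assoc (2 * (t + r + x)) t r ⟩
  2 * (t + r + x) ∸ (t + r)           ≡⟨ cong (_∸ (t + r)) (split t r x) ⟩
  (t + r + x + x) + (t + r) ∸ (t + r) ≡⟨ m+n∸n≡m (t + r + x + x) (t + r) ⟩
  t + r + x + x                       ∎
  where
  open ≡-Reasoning
  split : ∀ t r x → 2 * (t + r + x) ≡ (t + r + x + x) + (t + r)
  split = solve-∀

room : ∀ t r x s n → 2 * (t + r + x) + s ≤ n + t → ∃[ o ] n ≡ t + r + x + x + (r + s + o)
room t r x s n bound =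
  let (o , c+r+s+o≡n) = m≤n⇒∃[o]m+o≡n c+r+s≤n in o , trans (sym c+r+s+o≡n) (+-assoc (t + r + x + x) (r + s) o)
  where
  split : ∀ t r x s → 2 * (t + r + x) + s ≡ t + r + x + x + (r + s) + t
  split = solve-∀
  c+r+s≤n : t + r + x + x + (r + s) ≤ n
  c+r+s≤n = +-cancelʳ-≤ t (t + r + x + x + (r + s)) n (subst (_≤ n + t) (split t r x s) bound)

-- With n = k + x + m, the condition r < m says n - k > k - t, i.e. ℬ is empty at c = n.
top-room : ∀ t r x m → r < m → t + r + x < t + (x + m)
top-room t r x m r<m = subst (_< t + (x + m)) (swap t r x) (+-monoʳ-< t (+-monoʳ-< x r<m))
  where
  swap : ∀ t r x → t + (x + r) ≡ t + r + x
  swap = solve-∀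

-- A + t(x+m) compared with A + q + t·x is t·m compared with q.
top-shape : ∀ A t x m → A + t * (x + m) ≡ (A + t * x) + t * m
top-shape = solve-∀

below-shape : ∀ A q t x → A + q + t * x ≡ (A + t * x) + q
below-shape = solve-∀

-- C(m,2) > t·m as soon as m > 2t + 1, since 2·C(m,2) = m(m-1).
choose-2-large : ∀ t m → 2 * t + 1 < m → t * m < choose m 2
choose-2-large t m@(suc _) 2t+1<m = *-cancelˡ-< 2 (t * m) (choose m 2) (+-cancelʳ-< m (2 * (t * m)) (2 * choose m 2)
  (subst₂ _<_ (sym (regroup t m)) (sym (choose-2 m)) (*-monoˡ-< m 2t+1<m)))
  where
  regroup : ∀ t m → 2 * (t * m) + m ≡ (2 * t + 1) * m
  regroup = solve-∀

-- Part (i)/(ii), second claim: at c = 2k - t - 1 (one point of [n]∖C completes ℬ),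
-- h₁(n) - h₁(c) = (t-1)(n-c) ≥ 0, with equality only for t = 1.
gap-one : ∀ n t k → 1 ≤ t → t + 1 ≤ k → 2 * k + 1 ≤ n + t →
  (h1 n t k (2 * k ∸ t ∸ 1) ≤ h1 n t k n) × (h1 n t k n ≡ h1 n t k (2 * k ∸ t ∸ 1) → t ≡ 1)
gap-one n t@(suc _) k 1≤t t+1≤k bound with m≤n⇒∃[o]m+o≡n t+1≤k
... | x , refl with room t 1 x 1 n bound
... | o , n≡c+m rewrite twice-minus t 1 x = below≤top , equal⇒t≡1
  where
  m A : ℕ
  m = 2 + o
  A = sizeA n t k
  at-c : h1 n t k (k + x) ≡ A + t * x + m
  at-c = trans (h1-below t 1 x m 1≤t refl n≡c+m) (trans (cong (λ q → A + q + t * x) (choose-1 m)) (below-shape A m t x))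
  at-n : h1 n t k n ≡ A + t * x + t * m
  at-n = trans (h1-top t k (x + m) 1≤t (≤-trans (m≤m+n t 1) (m≤m+n (t + 1) x)) (trans n≡c+m (+-assoc k x m)) (top-room t 1 x m (s≤s (s≤s z≤n))))
               (top-shape A t x m)
  below≤top : h1 n t k (k + x) ≤ h1 n t k n
  below≤top = subst₂ _≤_ (sym at-c) (sym at-n) (+-monoʳ-≤ (A + t * x) (m≤n*m m t))
  equal⇒t≡1 : h1 n t k n ≡ h1 n t k (k + x) → t ≡ 1
  equal⇒t≡1 eq = *-cancelʳ-≡ t 1 m (trans (+-cancelˡ-≡ (A + t * x) (t * m) m (trans (sym at-n) (trans eq at-c)))
                                         (sym (*-identityˡ m)))

-- Part (i), first claim: at c = 2k - t - 2 (two points of [n]∖C complete ℬ),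
-- h₁(c) - h₁(n) = C(n-c,2) - t(n-c) > 0 once n ≥ 2k + t.
gap-two : ∀ n t k → 1 ≤ t → t + 2 ≤ k → 2 * k + t ≤ n → h1 n t k n < h1 n t k (2 * k ∸ t ∸ 2)
gap-two n t k 1≤t t+2≤k bound with m≤n⇒∃[o]m+o≡n t+2≤k
... | x , refl with room t 2 x (2 * t) n (subst (_≤ n + t) (double t x) (+-monoˡ-≤ t bound))
  where
  double : ∀ t x → 2 * (t + 2 + x) + t + t ≡ 2 * (t + 2 + x) + 2 * t
  double = solve-∀
... | o , n≡c+m rewrite twice-minus t 2 x =
  subst₂ _<_ (sym at-n) (sym at-c) (+-monoʳ-< (A + t * x) (choose-2-large t m (subst (_< m) (+-comm 1 (2 * t)) (s≤s (s≤s (m≤m+n (2 * t) o))))))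
  where
  m A : ℕ
  m = 2 + 2 * t + o
  A = sizeA n t k
  at-c : h1 n t k (k + x) ≡ A + t * x + choose m 2
  at-c = trans (h1-below t 2 x m 1≤t refl n≡c+m) (below-shape A (choose m 2) t x)
  at-n : h1 n t k n ≡ A + t * x + t * m
  at-n = trans (h1-top t k (x + m) 1≤t (≤-trans (m≤m+n t 2) (m≤m+n (t + 2) x)) (trans n≡c+m (+-assoc k x m))
                  (top-room t 2 x m (s≤s (s≤s (≤-trans 1≤t (≤-trans (m≤m+n t (t + 0)) (m≤m+n (2 * t) o))))))) (top-shape A t x m)

-- C(t+2,2) ≥ t + 1 (Pascal: C(t+2,2) = C(t+1,1) + C(t+1,2)).
C[t+2,2]≥t+1 : ∀ t → t + 1 ≤ (t + 2) C 2
C[t+2,2]≥t+1 t = subst (λ z → t + 1 ≤ z C 2) (+-comm 2 t)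
  (subst (t + 1 ≤_) (nCk+nC[k+1]≡[n+1]C[k+1] (suc t) 1)
    (≤-trans (≤-reflexive (trans (+-comm t 1) (sym (nC1≡n (suc t))))) (m≤m+n _ _)))

-- The hypothesis on n gives n ≥ 2k + t, which is all the comparisons need:
-- 2k ≤ (t+1)(k-t+1)² ≤ C(t+2,2)(k-t+1)² as soon as k > t.
n-large : ∀ t k n → t + 1 ≤ k → ((t + 2) C 2) * ((k ∸ t + 1) ^ 2) + t ≤ n → 2 * k + t ≤ n
n-large t k n t+1≤k bound with m≤n⇒∃[o]m+o≡n t+1≤k
... | s , refl = ≤-trans (+-monoˡ-≤ t 2k≤) bound
  where
  k-t+1 : t + 1 + s ∸ t + 1 ≡ s + 2
  k-t+1 = trans (cong (_+ 1) (trans (cong (_∸ t) (+-assoc t 1 s)) (m+n∸m≡n t (1 + s)))) (sym (+-suc s 1))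
  expand : ∀ t s → (t + 1) * ((s + 2) * ((s + 2) * 1)) ≡ 2 * (t + 1 + s) + (t * s * s + 4 * t * s + 2 * t + s * s + 2 * s + 2)
  expand = solve-∀
  2k≤ : 2 * (t + 1 + s) ≤ ((t + 2) C 2) * ((t + 1 + s ∸ t + 1) ^ 2)
  2k≤ = begin
    2 * (t + 1 + s)                       ≤⟨ m≤m+n _ _ ⟩
    2 * (t + 1 + s) + _                   ≡⟨ sym (expand t s) ⟩
    (t + 1) * ((s + 2) ^ 2)                 ≤⟨ *-monoˡ-≤ ((s + 2) ^ 2) (C[t+2,2]≥t+1 t) ⟩
    ((t + 2) C 2) * ((s + 2) ^ 2)             ≡⟨ cong (λ z → ((t + 2) C 2) * (z ^ 2)) (sym k-t+1) ⟩
    ((t + 2) C 2) * ((t + 1 + s ∸ t + 1) ^ 2) ∎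
    where open ≤-Reasoning

k+1≡2k-t-1 : ∀ t k → t + 2 ≤ k → t ≡ k ∸ 2 → k + 1 ≡ 2 * k ∸ t ∸ 1
k+1≡2k-t-1 t k t+2≤k t≡k-2 with sym (trans (cong (_+ 2) t≡k-2) (m∸n+n≡m (≤-trans (m≤n+m 2 t) t+2≤k)))
... | refl = begin
  t + 2 + 1                ≡⟨ cong (_+ 1) (sym (+-assoc t 1 1)) ⟩
  t + 1 + 1 + 1            ≡⟨ sym (twice-minus t 1 1) ⟩
  2 * (t + 1 + 1) ∸ t ∸ 1  ≡⟨ cong (λ k → 2 * k ∸ t ∸ 1) (+-assoc t 1 1) ⟩
  2 * (t + 2) ∸ t ∸ 1      ∎
  where open ≡-Reasoning

lemma2p9 : (n t k : ℕ) → 1 ≤ t → t + 2 ≤ k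
    → ((t + 2) C 2) * ((k ∸ t + 1) ^ 2) + t ≤ n
    → (t + 3 ≤ k
        → (h1 n t k (2 * k ∸ t ∸ 2) > h1 n t k n)
          × (h1 n t k n ≥ h1 n t k (2 * k ∸ t ∸ 1))
          × (h1 n t k n ≡ h1 n t k (2 * k ∸ t ∸ 1) → t ≡ 1))
      × (t ≡ k ∸ 2
        → (h1 n t k n ≥ h1 n t k (k + 1))
          × (h1 n t k n ≡ h1 n t k (k + 1) → t ≡ 1))
lemma2p9 n t k 1≤t t+2≤k bound = part-i , part-ii
  where
  t+1≤k : t + 1 ≤ k
  t+1≤k = ≤-trans (+-monoʳ-≤ t (s≤s z≤n)) t+2≤k
  n≥2k+t : 2 * k + t ≤ n
  n≥2k+t = n-large t k n t+1≤k bound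
  n+t≥2k+1 : 2 * k + 1 ≤ n + t
  n+t≥2k+1 = ≤-trans (+-monoʳ-≤ (2 * k) 1≤t) (≤-trans n≥2k+t (m≤m+n n t))
  -- Part (i) holds as soon as t + 2 ≤ k.
  part-i : t + 3 ≤ k → (h1 n t k (2 * k ∸ t ∸ 2) > h1 n t k n) × (h1 n t k n ≥ h1 n t k (2 * k ∸ t ∸ 1))
                        × (h1 n t k n ≡ h1 n t k (2 * k ∸ t ∸ 1) → t ≡ 1)
  part-i _ = gap-two n t k 1≤t t+2≤k n≥2k+t , gap-one n t k 1≤t t+1≤k n+t≥2k+1
  part-ii : t ≡ k ∸ 2 → (h1 n t k n ≥ h1 n t k (k + 1)) × (h1 n t k n ≡ h1 n t k (k + 1) → t ≡ 1)
  part-ii t≡k-2 rewrite k+1≡2k-t-1 t k t+2≤k t≡k-2 = gap-one n t k 1≤t t+1≤k n+t≥2k+1
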